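{- Let $\omega\in S_n$. If $\omega$ avoids the pattern $231$, then the poset $M_\omega$ is a disjoint union of chains.
   Context: Permutations are in one-line notation. ${\rm Inv}(\omega)=\{(i,j): 1\le i<j\le n,\ \omega(i)>\omega(j)\}$; $c_i(\omega)=\#\{j>i: \omega(i)>\omega(j)\}$; for $i<j$, $c_{i,j}(\omega)=\#\{k: i<k<j,\ \omega(i)>\omega(k)\}$; $[m]=\{1,\dots,m\}$. For $c_i(\omega)>0$ and $x\in[c_i(\omega)]$, $m_{i,x}(\omega)\in\mathbb{N}^n$ has $j$-th coordinate: $0$ if $(i,j)\in{\rm Inv}(\omega)$; $0$ if $j<i$; $x$ if $j=i$; $\max\{0,x-c_{i,j}(\omega)\}$ if $j>i$ and $(i,j)\notin{\rm Inv}(\omega)$. $M_\omega$ is the set of all such $m_{i,x}(\omega)$, ordered componentwise. $\omega$ avoids $231$ if there are no $i<j<l$ with $\omega(l)<\omega(i)<\omega(j)$. A disjoint union of chains means each connected component of the comparability graph is a chain. -}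

module Defs where

open import Data.Nat as ℕ using (ℕ; zero; suc; _∸_)
open import Data.Fin using (Fin; _<_)
open import Data.Fin.Properties using (_<?_; <-cmp)
open import Data.Fin.Permutation using (Permutation′; _⟨$⟩ʳ_)
open import Data.List using (List; length; filter; allFin)
open import Data.Vec using (Vec; tabulate)
open import Data.Vec.Relation.Binary.Pointwise.Inductive using (Pointwise)
open import Data.Product using (Σ; ∃; ∃-syntax; _×_; _,_)
open import Data.Sum using (_⊎_)
open import Relation.Nullary using (¬_)
open import Relation.Nullary.Decidable using (_×-dec_)
open import Relation.Binary using (Tri; tri<; tri≈; tri>)
open import Relation.Binary.PropositionalEquality using (_≡_)
open import Relation.Binary.Construct.Closure.ReflexiveTransitive using (Star)

-- Permutations of [n] are modelled as permutations of Fin n (0-indexed);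
-- ω(i) is  ω ⟨$⟩ʳ i.

Avoids231 : ∀ {n} → Permutation′ n → Set
Avoids231 {n} ω =
  ¬ (Σ (Fin n) λ i → Σ (Fin n) λ j → Σ (Fin n) λ l →
       i < j × j < l × (ω ⟨$⟩ʳ l) < (ω ⟨$⟩ʳ i) × (ω ⟨$⟩ʳ i) < (ω ⟨$⟩ʳ j))

Inv : ∀ {n} → Permutation′ n → Fin n → Fin n → Set
Inv ω i j = i < j × (ω ⟨$⟩ʳ j) < (ω ⟨$⟩ʳ i)

c : ∀ {n} → Permutation′ n → Fin n → ℕ
c {n} ω i = length (filter (λ j → (i <? j) ×-dec ((ω ⟨$⟩ʳ j) <? (ω ⟨$⟩ʳ i))) (allFin n))

cc : ∀ {n} → Permutation′ n → Fin n → Fin n → ℕ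
cc {n} ω i j =
  length (filter (λ k → (i <? k) ×-dec ((k <? j) ×-dec ((ω ⟨$⟩ʳ k) <? (ω ⟨$⟩ʳ i)))) (allFin n))

mCoord : ∀ {n} → Permutation′ n → Fin n → ℕ → Fin n → ℕ
mCoord ω i x j with <-cmp j i
... | tri< _ _ _ = 0
... | tri≈ _ _ _ = x
... | tri> _ _ _ with (ω ⟨$⟩ʳ j) <? (ω ⟨$⟩ʳ i)
...   | Relation.Nullary.yes _ = 0
...   | Relation.Nullary.no  _ = x ∸ cc ω i j

m : ∀ {n} → Permutation′ n → Fin n → ℕ → Vec ℕ n
m ω i x = tabulate (mCoord ω i x)

_∈M_ : ∀ {n} → Vec ℕ n → Permutation′ n → Set
_∈M_ {n} v ω = Σ (Fin n) λ i → Σ ℕ λ x → 1 ℕ.≤ x × x ℕ.≤ c ω i × v ≡ m ω i x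

_≼_ : ∀ {n} → Vec ℕ n → Vec ℕ n → Set
u ≼ v = Pointwise ℕ._≤_ u v

Comparable : ∀ {n} → Vec ℕ n → Vec ℕ n → Set
Comparable u v = u ≼ v ⊎ v ≼ u

Edge : ∀ {n} → Permutation′ n → Vec ℕ n → Vec ℕ n → Set
Edge ω u v = u ∈M ω × v ∈M ω × Comparable u v

-- M_ω is a disjoint union of chains: any two elements in the same connected
-- component of the comparability graph are comparable.
DisjointUnionOfChains : ∀ {n} → Permutation′ n → Set
DisjointUnionOfChains ω =
  ∀ u v → u ∈M ω → v ∈M ω → Star (Edge ω) u v → Comparable u v

module Submission where

open import Defs
open import Data.Nat using (ℕ; _≤_; z≤n)
open import Data.Fin.Permutation using (Permutation′; _⟨$⟩ʳ_)
open import Data.Nat.Properties using (≤-trans; ≤-total; ∸-monoˡ-≤; m≤n⇒m∸n≡0; ≮⇒≥; module ≤-Reasoning)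
open import Data.Fin using (Fin; _<_)
open import Data.Fin.Properties using (_≟_; _<?_; <-cmp; <-irrefl; <-asym; ≤∧≢⇒<; <⇒≢)
open import Data.List using (allFin)
open import Data.List.Relation.Binary.Sublist.Propositional using (⊆-refl)
open import Data.List.Relation.Binary.Sublist.Propositional.Properties using (filter⁺; length-mono-≤)
open import Data.Vec using (Vec; lookup)
open import Data.Vec.Properties using (lookup∘tabulate)
open import Data.Vec.Relation.Binary.Pointwise.Inductive as Pointwise using (tabulate⁺)
open import Data.Product using (∃; _×_; _,_)
open import Data.Sum using (inj₁; inj₂)
open import Data.Empty using (⊥-elim)
open import Function.Base using (_∘′_)
open import Function.Bundles using (Injection)
open import Function.Properties.Inverse using (↔⇒↣)
open import Relation.Nullary using (yes; no; contradiction)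
open import Relation.Binary using (tri<; tri≈; tri>)
open import Relation.Binary.PropositionalEquality using (_≡_; _≢_; refl; sym)
open import Relation.Binary.Construct.Closure.ReflexiveTransitive as Star using (Star)

-- When ω avoids 231, every j > i with ω(i) < ω(j) lies beyond all k > i with
-- ω(k) < ω(i); hence c_i(ω) ≤ c_{i,j}(ω), and m_{i,x}(ω) collapses to x·e_i.
-- So M_ω is the disjoint union of the chains {x·e_i : 1 ≤ x ≤ c_i(ω)}, and
-- two such vectors with different supports are incomparable.

module _ {n : ℕ} (ω : Permutation′ n) where

  private
    w : Fin n → Fin n
    w i = ω ⟨$⟩ʳ i

  Row : Fin n → Vec ℕ n → Set
  Row i v = ∃ λ x → 1 ≤ x × x ≤ c ω i × v ≡ m ω i x

  mCoord-diagonal : ∀ i x → mCoord ω i x i ≡ x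
  mCoord-diagonal i x with <-cmp i i
  ... | tri< i<i _ _ = ⊥-elim (<-irrefl refl i<i)
  ... | tri≈ _ _ _   = refl
  ... | tri> _ _ i<i = ⊥-elim (<-irrefl refl i<i)

  mCoord-monoˡ : ∀ i {x y} j → x ≤ y → mCoord ω i x j ≤ mCoord ω i y j
  mCoord-monoˡ i j x≤y with <-cmp j i
  ... | tri< _ _ _ = z≤n
  ... | tri≈ _ _ _ = x≤y
  ... | tri> _ _ _ with w j <? w i
  ...   | yes _ = z≤n
  ...   | no  _ = ∸-monoˡ-≤ (cc ω i j) x≤y

  m-monoˡ : ∀ i {x y} → x ≤ y → m ω i x ≼ m ω i y
  m-monoˡ i x≤y = tabulate⁺ (λ j → mCoord-monoˡ i j x≤y)

  Row-comparable : ∀ i {u v} → Row i u → Row i v → Comparable u v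
  Row-comparable i (x , _ , _ , refl) (y , _ , _ , refl) with ≤-total x y
  ... | inj₁ x≤y = inj₁ (m-monoˡ i x≤y)
  ... | inj₂ y≤x = inj₂ (m-monoˡ i y≤x)

  module _ (avoids : Avoids231 ω) where

    c≤cc : ∀ {i j} → i < j → w i < w j → c ω i ≤ cc ω i j
    c≤cc {i} {j} i<j wi<wj =
      length-mono-≤ (filter⁺ _ _ (λ { refl → below-j }) (⊆-refl {x = allFin n}))
      where
      below-j : ∀ {k} → i < k × w k < w i → i < k × k < j × w k < w i
      below-j {k} (i<k , wk<wi) with <-cmp k j
      ... | tri< k<j _ _  = i<k , k<j , wk<wi
      ... | tri≈ _ refl _ = ⊥-elim (<-asym wk<wi wi<wj)
      ... | tri> _ _ j<k  = ⊥-elim (avoids (i , j , k , i<j , j<k , wk<wi , wi<wj))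

    mCoord-off-diagonal : ∀ {i x} → x ≤ c ω i → ∀ j → j ≢ i → mCoord ω i x j ≡ 0
    mCoord-off-diagonal {i} {x} x≤c j j≢i with <-cmp j i
    ... | tri< _ _ _   = refl
    ... | tri≈ _ j≡i _ = contradiction j≡i j≢i
    ... | tri> _ _ i<j with w j <? w i
    ...   | yes _     = refl
    ...   | no  wj≮wi = m≤n⇒m∸n≡0 (≤-trans x≤c (c≤cc i<j wi<wj))
      where
      wi<wj : w i < w j
      wi<wj = ≤∧≢⇒< (≮⇒≥ wj≮wi) (<⇒≢ i<j ∘′ Injection.injective (↔⇒↣ ω))

    ≼-sameRow : ∀ {i j x y} → 1 ≤ x → y ≤ c ω j → m ω i x ≼ m ω j y → i ≡ j
    ≼-sameRow {i} {j} {x} {y} 1≤x y≤c m≼m with i ≟ j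
    ... | yes i≡j = i≡j
    ... | no  i≢j = contradiction 1≤0 λ ()
      where
      open ≤-Reasoning
      1≤0 : 1 ≤ 0
      1≤0 = begin
        1                      ≤⟨ 1≤x ⟩
        x                      ≡⟨ sym (mCoord-diagonal i x) ⟩
        mCoord ω i x i         ≡⟨ sym (lookup∘tabulate (mCoord ω i x) i) ⟩
        lookup (m ω i x) i     ≤⟨ Pointwise.lookup m≼m i ⟩
        lookup (m ω j y) i     ≡⟨ lookup∘tabulate (mCoord ω j y) i ⟩
        mCoord ω j y i         ≡⟨ mCoord-off-diagonal y≤c i i≢j ⟩
        0                      ∎

    Edge-preserves-Row : ∀ {i u v} → Row i u → Edge ω u v → Row i v
    Edge-preserves-Row (x , 1≤x , x≤c , refl) (_ , (j , y , 1≤y , y≤c , refl) , comparable)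
      with comparable
    ... | inj₁ u≼v rewrite ≼-sameRow 1≤x y≤c u≼v = y , 1≤y , y≤c , refl
    ... | inj₂ v≼u rewrite ≼-sameRow 1≤y x≤c v≼u = y , 1≤y , y≤c , refl

    Star-preserves-Row : ∀ i {u v} → Star (Edge ω) u v → Row i u → Row i v
    Star-preserves-Row i = Star.fold (λ u v → Row i u → Row i v)
      (λ edge rest row → rest (Edge-preserves-Row row edge)) (λ row → row)

mainTheorem2 : (n : ℕ) (ω : Permutation′ n) → Avoids231 ω → DisjointUnionOfChains ω
mainTheorem2 n ω avoids u v (i , u∈Row) _ path =
  Row-comparable ω i u∈Row (Star-preserves-Row ω avoids i path u∈Row)
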